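{- If $G$ is a total $k$-uniform graph, then either $G$ is the disjoint union of $k/2$ stars or the girth of $G$ is at most $6$.
   Context: All graphs are finite and simple. A star is a graph isomorphic to $K_{1,n}$ for some $n\ge 1$. The girth $g(G)$ is the length of a shortest cycle in $G$ (infinite if $G$ is acyclic). $N(v)$ is the set of neighbors of $v$. For a graph $G$ with no isolated vertices, a total dominating set is a set $A\subseteq V(G)$ such that every vertex of $G$ has a neighbor in $A$; $\gamma_t(G)$ is the minimum size of one. A sequence $(v_1,\dots,v_m)$ of distinct vertices is legal if $N(v_i)\setminus\bigcup_{j=1}^{i-1}N(v_j)\neq\emptyset$ for every $i\in\{2,\dots,m\}$; it is a total dominating sequence if moreover $\{v_1,\dots,v_m\}$ is a total dominating set. $\gamma_{gr}^t(G)$ is the maximum length of a total dominating sequence. $G$ is total $k$-uniform if $\gamma_t(G)=\gamma_{gr}^t(G)=k$. -}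

module Defs where

open import Data.Nat using (ℕ; _≤_; _*_)
open import Data.Fin using (Fin)
open import Data.Bool using (Bool; true; false)
open import Data.List using (List; []; _∷_; length)
open import Data.List.Membership.Propositional using (_∈_)
open import Data.List.Relation.Unary.All using (All)
open import Data.List.Relation.Unary.Unique.Propositional using (Unique)
open import Data.Product using (Σ; ∃; _×_; _,_)
open import Data.Sum using (_⊎_)
open import Data.Unit using (⊤)
open import Relation.Binary.PropositionalEquality using (_≡_; _≢_)
open import Relation.Nullary using (¬_)

record Graph : Set where
  field
    n      : ℕ
    adj    : Fin n → Fin n → Bool
    sym    : ∀ u v → adj u v ≡ adj v u
    irrefl : ∀ v → adj v v ≡ false

module _ (G : Graph) where
  open Graph G

  V : Set
  V = Fin n

  Adj : V → V → Set
  Adj v u = adj v u ≡ true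

  NoIsolated : Set
  NoIsolated = ∀ v → ∃ λ u → Adj v u

  -- A is a total dominating set (sets represented by duplicate-free lists)
  TotalDominating : List V → Set
  TotalDominating A = ∀ v → ∃ λ a → (a ∈ A) × Adj v a

  GammaT≡ : ℕ → Set
  GammaT≡ k =
    (Σ (List V) λ A → Unique A × TotalDominating A × length A ≡ k) ×
    (∀ (A : List V) → Unique A → TotalDominating A → k ≤ length A)

  LegalFrom : List V → List V → Set
  LegalFrom prev []       = ⊤
  LegalFrom prev (v ∷ vs) =
    (∃ λ u → Adj v u × All (λ w → ¬ Adj w u) prev) × LegalFrom (v ∷ prev) vs

  Legal : List V → Set
  Legal []       = ⊤
  Legal (v ∷ vs) = LegalFrom (v ∷ []) vs

  TotalDominatingSequence : List V → Set
  TotalDominatingSequence S = Unique S × Legal S × TotalDominating S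

  GammaGrT≡ : ℕ → Set
  GammaGrT≡ k =
    (Σ (List V) λ S → TotalDominatingSequence S × length S ≡ k) ×
    (∀ (S : List V) → TotalDominatingSequence S → length S ≤ k)

  -- total k-uniform (the definition of γ_t requires no isolated vertices)
  TotalUniform : ℕ → Set
  TotalUniform k = NoIsolated × GammaT≡ k × GammaGrT≡ k

  PathTo : V → List V → V → Set
  PathTo x []       last = x ≡ last
  PathTo x (y ∷ ys) last = Adj x y × PathTo y ys last

  HasCycleOfLength : ℕ → Set
  HasCycleOfLength ℓ =
    Σ V λ v₀ → Σ (List V) λ rest → Σ V λ vlast →
      Unique (v₀ ∷ rest) × length (v₀ ∷ rest) ≡ ℓ × 3 ≤ ℓ ×
      PathTo v₀ rest vlast × Adj vlast v₀

  GirthAtMost6 : Set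
  GirthAtMost6 = ∃ λ ℓ → ℓ ≤ 6 × HasCycleOfLength ℓ

  -- G is a disjoint union of m stars: the vertex set is partitioned into m
  -- nonempty classes (comp), every edge lies inside a class, and each class
  -- induces a star K_{1,r} (r ≥ 1) with a centre adjacent to every other
  -- vertex of the class and no other edges inside the class.
  DisjointUnionOfStars : ℕ → Set
  DisjointUnionOfStars m =
    Σ (V → Fin m) λ comp →
    Σ (Fin m → V) λ centre →
      (∀ i → comp (centre i) ≡ i) ×
      (∀ i → ∃ λ v → comp v ≡ i × v ≢ centre i) ×
      (∀ u v → Adj u v → comp u ≡ comp v) ×
      (∀ u v → comp u ≡ comp v →
         (Adj u v → (u ≡ centre (comp u) ⊎ v ≡ centre (comp u))) ×
         (u ≢ v → (u ≡ centre (comp u) ⊎ v ≡ centre (comp u)) → Adj u v))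

-- A closed non-backtracking walk of length 4 or 6 contains a cycle of length at most 6,
-- so assume there is none.  If some vertex b has every edge b y continuing to a
-- non-backtracking walk b y z t, let Z be the set of all such z.  Each z ∈ Z has t as a
-- private neighbour (a second vertex of Z adjacent to t would close such a walk), so
-- b, Z is legal and extends greedily to a total dominating sequence b, Z, T.  As Z
-- dominates N(b), Z ∪ T is already a total dominating set, contradicting γ_gr^t = γ_t.
-- Hence every vertex has an edge at which all walks backtrack, which rules out
-- non-backtracking walks of length 3 altogether: G is a disjoint union of m stars, and
-- the centres together with one leaf of each star form a total dominating set that is
-- also a legal sequence, so k = 2m.
{-# OPTIONS --safe #-}
module Submission where

open import Defs
open import Data.Bool using (true)
open import Data.Bool.Properties using () renaming (_≟_ to _≟ᵇ_)
open import Data.Empty using (⊥; ⊥-elim)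
open import Data.Fin using (Fin; _<_; zero; suc)
open import Data.Fin.Properties using (_≟_; _<?_; <-asym; <-cmp; any?; all?; ¬∀⟶∃¬)
open import Data.List using (List; []; _∷_; [_]; _++_; _ʳ++_; map; filter; allFin; length; lookup)
open import Data.List.Properties using (length-++; length-map; length-tabulate)
open import Data.List.Membership.Propositional using (_∈_; _∉_; find)
open import Data.List.Membership.Propositional.Properties
  using (∈-++⁺ˡ; ∈-++⁺ʳ; ∈-++⁻; ∈-map⁺; ∈-map⁻; ∈-allFin; ∈-filter⁺; ∈-filter⁻; ∈-lookup)
open import Data.List.Relation.Unary.All as All using (All; []; _∷_)
open import Data.List.Relation.Unary.All.Properties using (¬Any⇒All¬) renaming (++⁺ to All-++⁺)
open import Data.List.Relation.Unary.AllPairs using ([]; _∷_)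
open import Data.List.Relation.Unary.Any as Any using (here; there)
open import Data.List.Relation.Unary.Any.Properties using (lookup-index; reverseAcc⁻; reverseAcc⁺)
open import Data.List.Relation.Unary.Unique.Propositional using (Unique)
import Data.List.Relation.Unary.Unique.Propositional.Properties as Unique
open import Data.Nat using (ℕ; _*_; _+_)
open import Data.Nat.Properties using (≤-refl; ≤-trans; ≤-antisym; m≤m+n; +-identityʳ; 1+n≰n)
open import Data.Product using (Σ; ∃; ∃₂; _×_; _,_; proj₁; proj₂)
open import Data.Sum using (_⊎_; inj₁; inj₂)
import Data.Sum as Sum
open import Data.Unit using (tt)
open import Function using (_∘_; id; case_of_)
open import Relation.Binary.Definitions using (tri<; tri≈; tri>)
open import Relation.Binary.PropositionalEquality
  using (_≡_; _≢_; refl; sym; trans; cong; cong₂; subst; ≢-sym; module ≡-Reasoning)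
open import Relation.Nullary using (¬_; Dec; yes; no)
open import Relation.Nullary.Decidable using (¬?; _×-dec_; _→-dec_; toSum)

index-of-lookup : ∀ {A : Set} {xs : List A} {x} → Unique xs → (x∈xs : x ∈ xs) →
                  ∀ {i} → x ≡ lookup xs i → Any.index x∈xs ≡ i
index-of-lookup _          (here refl) {zero}  _  = refl
index-of-lookup (x∉ ∷ _)   (here refl) {suc i} eq = ⊥-elim (All.lookup x∉ (∈-lookup i) eq)
index-of-lookup (y∉ ∷ _)   (there x∈)  {zero}  eq = ⊥-elim (All.lookup y∉ x∈ (sym eq))
index-of-lookup (_ ∷ uniq) (there x∈)  {suc i} eq = cong suc (index-of-lookup uniq x∈ eq)

module _ (G : Graph) where
  open Graph G using (n; adj)

  infix 4 _∼_
  _∼_ : V G → V G → Set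
  _∼_ = Adj G

  _∼?_ : ∀ u v → Dec (u ∼ v)
  u ∼? v = adj u v ≟ᵇ true

  ∼-sym : ∀ {u v} → u ∼ v → v ∼ u
  ∼-sym {u} {v} u∼v = trans (Graph.sym G v u) u∼v

  ∼⇒≢ : ∀ {u v} → u ∼ v → u ≢ v
  ∼⇒≢ {u} u∼u refl = case trans (sym u∼u) (Graph.irrefl G u) of λ ()

  -- Short non-backtracking walks

  Walk₃ : V G → V G → V G → V G → Set
  Walk₃ a b c d = a ∼ b × b ∼ c × c ∼ d × a ≢ c × b ≢ d

  walk₃? : ∀ a b c d → Dec (Walk₃ a b c d)
  walk₃? a b c d = a ∼? b ×-dec b ∼? c ×-dec c ∼? d ×-dec ¬? (a ≟ c) ×-dec ¬? (b ≟ d)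

  -- Square and Hexagon encode closed non-backtracking walks of length 4 and 6.
  Square : V G → V G → V G → V G → Set
  Square a b c d = Walk₃ a b c d × d ∼ a

  square? : ∀ a b c d → Dec (Square a b c d)
  square? a b c d = walk₃? a b c d ×-dec d ∼? a

  Hexagon : V G → V G → V G → V G → V G → V G → Set
  Hexagon v₀ v₁ v₂ v₃ v₄ v₅ = Walk₃ v₀ v₁ v₂ v₃ × Walk₃ v₃ v₄ v₅ v₀ × v₂ ≢ v₄ × v₅ ≢ v₁

  hexagon? : ∀ v₀ v₁ v₂ v₃ v₄ v₅ → Dec (Hexagon v₀ v₁ v₂ v₃ v₄ v₅)
  hexagon? v₀ v₁ v₂ v₃ v₄ v₅ =
    walk₃? v₀ v₁ v₂ v₃ ×-dec walk₃? v₃ v₄ v₅ v₀ ×-dec ¬? (v₂ ≟ v₄) ×-dec ¬? (v₅ ≟ v₁)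

  triangle⇒girth≤6 : ∀ {a b c} → a ∼ b → b ∼ c → c ∼ a → GirthAtMost6 G
  triangle⇒girth≤6 {a} {b} {c} ab bc ca =
    3 , m≤m+n 3 3 , a , b ∷ c ∷ [] , c ,
    ((∼⇒≢ ab ∷ ≢-sym (∼⇒≢ ca) ∷ []) ∷ (∼⇒≢ bc ∷ []) ∷ [] ∷ []) ,
    refl , ≤-refl , (ab , bc , refl) , ca

  square⇒girth≤6 : ∀ {a b c d} → Square a b c d → GirthAtMost6 G
  square⇒girth≤6 {a} {b} {c} {d} ((ab , bc , cd , a≢c , b≢d) , da) =
    4 , m≤m+n 4 2 , a , b ∷ c ∷ d ∷ [] , d ,
    ((∼⇒≢ ab ∷ a≢c ∷ ≢-sym (∼⇒≢ da) ∷ []) ∷ (∼⇒≢ bc ∷ b≢d ∷ []) ∷ (∼⇒≢ cd ∷ []) ∷ [] ∷ []) ,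
    refl , m≤m+n 3 1 , (ab , bc , cd , refl) , da

  -- A hexagon whose opposite vertices coincide is a triangle traversed twice.
  hexagon⇒girth≤6 : ∀ {v₀ v₁ v₂ v₃ v₄ v₅} → Hexagon v₀ v₁ v₂ v₃ v₄ v₅ → GirthAtMost6 G
  hexagon⇒girth≤6 {v₀} {v₁} {v₂} {v₃} {v₄} {v₅}
    ((p₀₁ , p₁₂ , p₂₃ , v₀≢v₂ , v₁≢v₃) , (p₃₄ , p₄₅ , p₅₀ , v₃≢v₅ , v₄≢v₀) , v₂≢v₄ , v₅≢v₁)
    with v₀ ≟ v₃ | v₁ ≟ v₄ | v₂ ≟ v₅
  ... | yes refl | _        | _        = triangle⇒girth≤6 p₀₁ p₁₂ p₂₃
  ... | no _     | yes refl | _        = triangle⇒girth≤6 p₁₂ p₂₃ p₃₄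
  ... | no _     | no _     | yes refl = triangle⇒girth≤6 p₂₃ p₃₄ p₄₅
  ... | no v₀≢v₃ | no v₁≢v₄ | no v₂≢v₅ =
    6 , ≤-refl , v₀ , v₁ ∷ v₂ ∷ v₃ ∷ v₄ ∷ v₅ ∷ [] , v₅ ,
    ((∼⇒≢ p₀₁ ∷ v₀≢v₂ ∷ v₀≢v₃ ∷ ≢-sym v₄≢v₀ ∷ ≢-sym (∼⇒≢ p₅₀) ∷ []) ∷
     (∼⇒≢ p₁₂ ∷ v₁≢v₃ ∷ v₁≢v₄ ∷ ≢-sym v₅≢v₁ ∷ []) ∷
     (∼⇒≢ p₂₃ ∷ v₂≢v₄ ∷ v₂≢v₅ ∷ []) ∷
     (∼⇒≢ p₃₄ ∷ v₃≢v₅ ∷ []) ∷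
     (∼⇒≢ p₄₅ ∷ []) ∷ [] ∷ []) ,
    refl , m≤m+n 3 3 , (p₀₁ , p₁₂ , p₂₃ , p₃₄ , p₄₅ , refl) , p₅₀

  SquareFree : Set
  SquareFree = ∀ {a b c d} → ¬ Square a b c d

  HexagonFree : Set
  HexagonFree = ∀ {v₀ v₁ v₂ v₃ v₄ v₅} → ¬ Hexagon v₀ v₁ v₂ v₃ v₄ v₅

  girth≤6⊎squareFree×hexagonFree : GirthAtMost6 G ⊎ (SquareFree × HexagonFree)
  girth≤6⊎squareFree×hexagonFree
    with any? (λ a → any? λ b → any? λ c → any? λ d → square? a b c d)
  ... | yes (_ , _ , _ , _ , sq) = inj₁ (square⇒girth≤6 sq)
  ... | no noSquare
    with any? (λ v₀ → any? λ v₁ → any? λ v₂ → any? λ v₃ → any? λ v₄ → any? λ v₅ →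
           hexagon? v₀ v₁ v₂ v₃ v₄ v₅)
  ...   | yes (_ , _ , _ , _ , _ , _ , hex) = inj₁ (hexagon⇒girth≤6 hex)
  ...   | no noHexagon =
    inj₂ ( (λ sq → noSquare (_ , _ , _ , _ , sq))
         , (λ hex → noHexagon (_ , _ , _ , _ , _ , _ , hex)))

  PrivateNeighbour : List (V G) → List (V G) → V G → V G → Set
  PrivateNeighbour prev xs x u =
    x ∼ u × All (λ w → ¬ w ∼ u) prev × (∀ {w} → w ∈ xs → w ∼ u → w ≡ x)

  legalFrom-privateNeighbours : ∀ prev xs → Unique xs →
    (∀ {x} → x ∈ xs → ∃ (PrivateNeighbour prev xs x)) → LegalFrom G prev xs
  legalFrom-privateNeighbours prev []       _            _    = tt
  legalFrom-privateNeighbours prev (x ∷ xs) (x∉xs ∷ uxs) priv =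
    (u , x∼u , prev≁u) , legalFrom-privateNeighbours (x ∷ prev) xs uxs priv′
    where
    u = proj₁ (priv (here refl))
    x∼u = proj₁ (proj₂ (priv (here refl)))
    prev≁u = proj₁ (proj₂ (proj₂ (priv (here refl))))
    priv′ : ∀ {y} → y ∈ xs → ∃ (PrivateNeighbour (x ∷ prev) xs y)
    priv′ y∈xs with priv (there y∈xs)
    ... | v , y∼v , prev≁v , only =
      v , y∼v , (λ x∼v → All.lookup x∉xs y∈xs (only (here refl) x∼v)) ∷ prev≁v , only ∘ there

  legalFrom[]⇒legal : ∀ {xs} → LegalFrom G [] xs → Legal G xs
  legalFrom[]⇒legal {[]}    _          = tt
  legalFrom[]⇒legal {_ ∷ _} (_ , legal) = legal

  legalFrom-++ : ∀ prev xs {ys} → LegalFrom G prev xs → LegalFrom G (xs ʳ++ prev) ys →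
                 LegalFrom G prev (xs ++ ys)
  legalFrom-++ prev []       _               legal-ys = legal-ys
  legalFrom-++ prev (x ∷ xs) (x-ok , legal) legal-ys =
    x-ok , legalFrom-++ (x ∷ prev) xs legal legal-ys

  record LegalExtension (prev vs : List (V G)) : Set where
    field
      rest      : List (V G)
      legal     : LegalFrom G prev rest
      fresh     : All (_∉ prev) rest
      unique    : Unique rest
      dominates : ∀ {v} → v ∈ vs → ∃ λ a → (a ∈ prev ⊎ a ∈ rest) × v ∼ a

  -- Each vertex of vs not yet dominated gets dominated by appending a neighbour of it,
  -- whose private neighbour is that vertex itself.
  greedyExtension : NoIsolated G → ∀ prev vs → LegalExtension prev vs
  greedyExtension noIsolated prev [] =
    record { rest = [] ; legal = tt ; fresh = [] ; unique = [] ; dominates = λ () }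
  greedyExtension noIsolated prev (v ∷ vs) with Any.any? (v ∼?_) prev
  ... | yes dominated = record
    { rest      = E.rest
    ; legal     = E.legal
    ; fresh     = E.fresh
    ; unique    = E.unique
    ; dominates = λ { (here refl) → a , inj₁ a∈ , v∼a ; (there x∈) → E.dominates x∈ }
    }
    where
    module E = LegalExtension (greedyExtension noIsolated prev vs)
    a = proj₁ (find dominated)
    a∈ = proj₁ (proj₂ (find dominated))
    v∼a = proj₂ (proj₂ (find dominated))
  ... | no undominated = record
    { rest      = w ∷ E.rest
    ; legal     = (v , ∼-sym v∼w , All.map (λ v≁x x∼v → v≁x (∼-sym x∼v)) v≁prev) , E.legal
    ; fresh     = (λ w∈ → All.lookup v≁prev w∈ v∼w) ∷ All.map (λ ∉w∷prev → ∉w∷prev ∘ there) E.fresh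
    ; unique    = All.map (λ ∉w∷prev w≡x → ∉w∷prev (here (sym w≡x))) E.fresh ∷ E.unique
    ; dominates = λ { (here refl) → w , inj₂ (here refl) , v∼w
                    ; (there x∈) → shift (E.dominates x∈) }
    }
    where
    w = proj₁ (noIsolated v)
    v∼w = proj₂ (noIsolated v)
    v≁prev = ¬Any⇒All¬ prev undominated
    module E = LegalExtension (greedyExtension noIsolated (w ∷ prev) vs)
    shift : ∀ {x} → (∃ λ a → (a ∈ w ∷ prev ⊎ a ∈ E.rest) × x ∼ a) →
            ∃ λ a → (a ∈ prev ⊎ a ∈ w ∷ E.rest) × x ∼ a
    shift (a , inj₁ (here refl) , x∼a) = a , inj₂ (here refl) , x∼a
    shift (a , inj₁ (there a∈) , x∼a)  = a , inj₁ a∈ , x∼a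
    shift (a , inj₂ a∈ , x∼a)          = a , inj₂ (there a∈) , x∼a

  -- The greedy completion b, Z, T is a total dominating sequence one longer than the
  -- total dominating set Z ∪ T.
  uniform⇒¬redundantHead : ∀ {k} → TotalUniform G k → ∀ {b Z} → Unique (b ∷ Z) →
    LegalFrom G [ b ] Z → (∀ {y} → b ∼ y → ∃ λ z → z ∈ Z × y ∼ z) → ⊥
  uniform⇒¬redundantHead (noIsolated , (_ , γt-minimal) , (_ , γgr-maximal)) {b} {Z}
                         (b∉Z ∷ uZ) legal-Z Z-dominates-N[b] =
    1+n≰n (≤-trans (γgr-maximal (b ∷ A) (b∉A ∷ uA , legal-bA , td-bA)) (γt-minimal A uA td-A))
    where
    prev = Z ʳ++ [ b ]
    open LegalExtension (greedyExtension noIsolated prev (allFin n)) renaming (rest to T)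
    A = Z ++ T

    b∈prev : b ∈ prev
    b∈prev = reverseAcc⁺ [ b ] Z (inj₁ (here refl))

    Z⊆prev : ∀ {z} → z ∈ Z → z ∈ prev
    Z⊆prev z∈ = reverseAcc⁺ [ b ] Z (inj₂ z∈)

    uA : Unique A
    uA = Unique.++⁺ uZ unique λ (z∈Z , z∈T) → All.lookup fresh z∈T (Z⊆prev z∈Z)

    b∉A : All (b ≢_) A
    b∉A = All-++⁺ b∉Z (All.map (λ t∉prev b≡t → t∉prev (subst (_∈ prev) b≡t b∈prev)) fresh)

    legal-bA : Legal G (b ∷ A)
    legal-bA = legalFrom-++ [ b ] Z legal-Z legal

    dominator : ∀ v → ∃ λ a → (a ≡ b ⊎ a ∈ Z ⊎ a ∈ T) × v ∼ a
    dominator v with dominates (∈-allFin v)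
    ... | a , inj₂ a∈T , v∼a = a , inj₂ (inj₂ a∈T) , v∼a
    ... | a , inj₁ a∈prev , v∼a with reverseAcc⁻ [ b ] Z a∈prev
    ...   | inj₁ (here a≡b) = a , inj₁ a≡b , v∼a
    ...   | inj₂ a∈Z        = a , inj₂ (inj₁ a∈Z) , v∼a

    td-bA : TotalDominating G (b ∷ A)
    td-bA v with dominator v
    ... | a , inj₁ refl , v∼b          = b , here refl , v∼b
    ... | a , inj₂ (inj₁ a∈Z) , v∼a    = a , there (∈-++⁺ˡ a∈Z) , v∼a
    ... | a , inj₂ (inj₂ a∈T) , v∼a    = a , there (∈-++⁺ʳ Z a∈T) , v∼a

    td-A : TotalDominating G A
    td-A v with dominator v
    ... | a , inj₁ refl , v∼b          = let z , z∈Z , v∼z = Z-dominates-N[b] (∼-sym v∼b)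
                                         in z , ∈-++⁺ˡ z∈Z , v∼z
    ... | a , inj₂ (inj₁ a∈Z) , v∼a    = a , ∈-++⁺ˡ a∈Z , v∼a
    ... | a , inj₂ (inj₂ a∈T) , v∼a    = a , ∈-++⁺ʳ Z a∈T , v∼a

  EveryEdgeExtends : V G → Set
  EveryEdgeExtends b = ∀ y → b ∼ y → ∃₂ λ z t → Walk₃ b y z t

  module _ (squareFree : SquareFree) (hexagonFree : HexagonFree) (b : V G) where

    ThirdVertex : V G → Set
    ThirdVertex z = ∃₂ λ y t → Walk₃ b y z t

    thirdVertex? : ∀ z → Dec (ThirdVertex z)
    thirdVertex? z = any? λ y → any? λ t → walk₃? b y z t

    thirdVertices : List (V G)
    thirdVertices = filter thirdVertex? (allFin n)

    ∈thirdVertices⁻ : ∀ {z} → z ∈ thirdVertices → ThirdVertex z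
    ∈thirdVertices⁻ z∈ = proj₂ (∈-filter⁻ thirdVertex? {xs = allFin n} z∈)

    ∈thirdVertices⁺ : ∀ {y z t} → Walk₃ b y z t → z ∈ thirdVertices
    ∈thirdVertices⁺ {y} {z} {t} walk = ∈-filter⁺ thirdVertex? (∈-allFin z) (y , t , walk)

    unique-thirdVertices : Unique thirdVertices
    unique-thirdVertices = Unique.filter⁺ thirdVertex? (Unique.allFin⁺ n)

    thirdVertices-privateNeighbour : ∀ {z} → z ∈ thirdVertices →
      ∃ (PrivateNeighbour [ b ] thirdVertices z)
    thirdVertices-privateNeighbour {z} z∈ with ∈thirdVertices⁻ z∈
    ... | y , t , walk@(b∼y , y∼z , z∼t , b≢z , y≢t) = t , z∼t , b≁t ∷ [] , only
      where
      b≁t : ¬ b ∼ t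
      b≁t b∼t = squareFree (walk , ∼-sym b∼t)
      only : ∀ {x} → x ∈ thirdVertices → x ∼ t → x ≡ z
      only {x} x∈ x∼t with x ≟ z | ∈thirdVertices⁻ x∈
      ... | yes x≡z | _ = x≡z
      ... | no x≢z  | y′ , _ , b∼y′ , y′∼x , _ , b≢x , _ with y′ ≟ y
      ...   | yes refl =
        ⊥-elim (squareFree ((y∼z , z∼t , ∼-sym x∼t , y≢t , ≢-sym x≢z) , ∼-sym y′∼x))
      ...   | no y′≢y  =
        ⊥-elim (hexagonFree ( walk
                            , (∼-sym x∼t , ∼-sym y′∼x , ∼-sym b∼y′ , t≢y′ , ≢-sym b≢x)
                            , ≢-sym x≢z , y′≢y))
        where
        t≢y′ : t ≢ y′
        t≢y′ refl = b≁t b∼y′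

    unique-b∷thirdVertices : Unique (b ∷ thirdVertices)
    unique-b∷thirdVertices =
      All.tabulate (λ z∈ → let _ , _ , _ , _ , _ , b≢z , _ = ∈thirdVertices⁻ z∈ in b≢z) ∷
      unique-thirdVertices

    uniform⇒¬everyEdgeExtends : ∀ {k} → TotalUniform G k → ¬ EveryEdgeExtends b
    uniform⇒¬everyEdgeExtends uniform extends =
      uniform⇒¬redundantHead uniform unique-b∷thirdVertices
        (legalFrom-privateNeighbours [ b ] thirdVertices unique-thirdVertices
                                     thirdVertices-privateNeighbour)
        λ {y} b∼y → let z , t , walk = extends y b∼y in
                    z , ∈thirdVertices⁺ walk , proj₁ (proj₂ walk)

  DeadEnd : V G → V G → Set
  DeadEnd v y = v ∼ y × (∀ {z t} → ¬ Walk₃ v y z t)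

  ¬everyEdgeExtends⇒deadEnd : ∀ {v} → ¬ EveryEdgeExtends v → ∃ (DeadEnd v)
  ¬everyEdgeExtends⇒deadEnd {v} ¬extends
    with ¬∀⟶∃¬ n _ (λ y → v ∼? y →-dec any? λ z → any? λ t → walk₃? v y z t) ¬extends
  ... | y , ¬extends-at-y with v ∼? y
  ...   | yes v∼y = y , v∼y , λ walk → ¬extends-at-y λ _ → _ , _ , walk
  ...   | no  v≁y = ⊥-elim (¬extends-at-y (⊥-elim ∘ v≁y))

  deadEnds⇒walk₃-free : (∀ v → ∃ (DeadEnd v)) → ∀ {a b c d} → ¬ Walk₃ a b c d
  deadEnds⇒walk₃-free dead {a} {b} {c} {d} walk@(a∼b , b∼c , _ , a≢c , _) with dead a
  ... | y , a∼y , a-y-dead with y ≟ b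
  ...   | yes refl = a-y-dead walk
  ...   | no y≢b with dead y
  ...     | y′ , y∼y′ , y-y′-dead with y′ ≟ a
  ...       | yes refl = y-y′-dead (y∼y′ , a∼b , b∼c , y≢b , a≢c)
  ...       | no y′≢a with dead y′
  ...         | y″ , y′∼y″ , y′-y″-dead with y″ ≟ y
  ...           | yes refl = y′-y″-dead (y′∼y″ , ∼-sym a∼y , a∼b , y′≢a , y≢b)
  ...           | no y″≢y  = a-y-dead (a∼y , y∼y′ , y′∼y″ , ≢-sym y′≢a , ≢-sym y″≢y)

  -- Graphs without non-backtracking walks of length 3

  module StarForest (noIsolated : NoIsolated G) (walk₃-free : ∀ {a b c d} → ¬ Walk₃ a b c d) where

    nb : V G → V G
    nb v = proj₁ (noIsolated v)

    ∼nb : ∀ v → v ∼ nb v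
    ∼nb v = proj₂ (noIsolated v)

    Leaf : V G → Set
    Leaf v = ∀ w → v ∼ w → w ≡ nb v

    leaf? : ∀ v → Dec (Leaf v)
    leaf? v = all? λ w → v ∼? w →-dec w ≟ nb v

    nonLeaf⇒neighbour≢ : ∀ {v} → ¬ Leaf v → ∀ w → ∃ λ y → v ∼ y × y ≢ w
    nonLeaf⇒neighbour≢ {v} ¬leaf w with ¬∀⟶∃¬ n _ (λ y → v ∼? y →-dec y ≟ nb v) ¬leaf
    ... | y , ¬[v∼y⇒y≡nb] with v ∼? y | y ≟ nb v
    ...   | no v≁y | _         = ⊥-elim (¬[v∼y⇒y≡nb] (⊥-elim ∘ v≁y))
    ...   | yes _  | yes y≡nb  = ⊥-elim (¬[v∼y⇒y≡nb] λ _ → y≡nb)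
    ...   | yes v∼y | no y≢nb with y ≟ w
    ...     | yes refl = nb v , ∼nb v , ≢-sym y≢nb
    ...     | no y≢w   = y , v∼y , y≢w

    edge⇒leaf : ∀ {u v} → u ∼ v → Leaf u ⊎ Leaf v
    edge⇒leaf {u} {v} u∼v with leaf? u | leaf? v
    ... | yes leaf-u | _          = inj₁ leaf-u
    ... | no _       | yes leaf-v = inj₂ leaf-v
    ... | no ¬leaf-u | no ¬leaf-v
      with nonLeaf⇒neighbour≢ ¬leaf-u v | nonLeaf⇒neighbour≢ ¬leaf-v u
    ...   | x , u∼x , x≢v | y , v∼y , y≢u =
      ⊥-elim (walk₃-free (∼-sym u∼x , u∼v , v∼y , x≢v , ≢-sym y≢u))

    nb-nb : ∀ {v} → Leaf (nb v) → nb (nb v) ≡ v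
    nb-nb {v} leaf-nb = sym (leaf-nb v (∼-sym (∼nb v)))

    -- A satellite is a leaf pointing at the centre of its star; in a K₂ component both
    -- ends are leaves and the larger one is the satellite.
    Satellite : V G → Set
    Satellite v = Leaf v × (Leaf (nb v) → nb v < v)

    satellite? : ∀ v → Dec (Satellite v)
    satellite? v = leaf? v ×-dec (leaf? (nb v) →-dec nb v <? v)

    satellite⇒¬satellite-nb : ∀ {v} → Satellite v → ¬ Satellite (nb v)
    satellite⇒¬satellite-nb {v} (leaf-v , nb<v) (leaf-nb , nb-nb<nb) =
      <-asym (nb<v leaf-nb) (subst (_< nb v) (nb-nb leaf-nb)
                              (nb-nb<nb (subst Leaf (sym (nb-nb leaf-nb)) leaf-v)))

    centreOf : V G → V G
    centreOf v with satellite? v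
    ... | yes _ = nb v
    ... | no  _ = v

    satellite-centreOf : ∀ {v} → Satellite v → centreOf v ≡ nb v
    satellite-centreOf {v} sat with satellite? v
    ... | yes _   = refl
    ... | no ¬sat = ⊥-elim (¬sat sat)

    nonSatellite-centreOf : ∀ {v} → ¬ Satellite v → centreOf v ≡ v
    nonSatellite-centreOf {v} ¬sat with satellite? v
    ... | yes sat = ⊥-elim (¬sat sat)
    ... | no _    = refl

    leaf⇒satellite⊎satellite-nb : ∀ {v} → Leaf v → Satellite v ⊎ Satellite (nb v)
    leaf⇒satellite⊎satellite-nb {v} leaf-v with leaf? (nb v)
    ... | no ¬leaf-nb = inj₁ (leaf-v , ⊥-elim ∘ ¬leaf-nb)
    ... | yes leaf-nb with <-cmp (nb v) v
    ...   | tri< nb<v _ _ = inj₁ (leaf-v , λ _ → nb<v)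
    ...   | tri≈ _ nb≡v _ = ⊥-elim (∼⇒≢ (∼nb v) (sym nb≡v))
    ...   | tri> _ _ v<nb = inj₂ (leaf-nb , λ _ → subst (_< nb v) (sym (nb-nb leaf-nb)) v<nb)

    leaf-centreOf : ∀ {v} → Leaf v → centreOf v ≡ centreOf (nb v)
    leaf-centreOf {v} leaf-v with leaf⇒satellite⊎satellite-nb leaf-v
    ... | inj₁ sat    = trans (satellite-centreOf sat)
                              (sym (nonSatellite-centreOf (satellite⇒¬satellite-nb sat)))
    ... | inj₂ sat-nb = trans (nonSatellite-centreOf (λ sat → satellite⇒¬satellite-nb sat sat-nb))
                              (sym (trans (satellite-centreOf sat-nb) (nb-nb (proj₁ sat-nb))))

    ∼⇒centreOf≡ : ∀ {u v} → u ∼ v → centreOf u ≡ centreOf v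
    ∼⇒centreOf≡ {u} {v} u∼v with edge⇒leaf u∼v
    ... | inj₁ leaf-u = trans (leaf-centreOf leaf-u) (cong centreOf (sym (leaf-u v u∼v)))
    ... | inj₂ leaf-v =
      sym (trans (leaf-centreOf leaf-v) (cong centreOf (sym (leaf-v u (∼-sym u∼v)))))

    ∼⇒centreOf-endpoint : ∀ {u v} → u ∼ v → u ≡ centreOf u ⊎ v ≡ centreOf u
    ∼⇒centreOf-endpoint {u} {v} u∼v with toSum (satellite? u)
    ... | inj₁ sat  = inj₂ (trans (proj₁ sat v u∼v) (sym (satellite-centreOf sat)))
    ... | inj₂ ¬sat = inj₁ (sym (nonSatellite-centreOf ¬sat))

    centreOf-idem : ∀ v → centreOf (centreOf v) ≡ centreOf v
    centreOf-idem v with ∼⇒centreOf-endpoint (∼nb v)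
    ... | inj₁ v≡c  = cong centreOf (sym v≡c)
    ... | inj₂ nb≡c = trans (cong centreOf (sym nb≡c)) (sym (∼⇒centreOf≡ (∼nb v)))

    ∼centreOf : ∀ {v} → v ≢ centreOf v → v ∼ centreOf v
    ∼centreOf {v} v≢c with toSum (satellite? v)
    ... | inj₁ sat  = subst (v ∼_) (sym (satellite-centreOf sat)) (∼nb v)
    ... | inj₂ ¬sat = ⊥-elim (v≢c (sym (nonSatellite-centreOf ¬sat)))

    centreOf≡⇒∼ : ∀ {u v} → centreOf v ≡ u → u ≢ v → v ∼ u
    centreOf≡⇒∼ {v = v} cv≡u u≢v =
      subst (v ∼_) cv≡u (∼centreOf λ v≡cv → u≢v (sym (trans v≡cv cv≡u)))

    centres : List (V G)
    centres = filter (λ c → centreOf c ≟ c) (allFin n)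

    unique-centres : Unique centres
    unique-centres = Unique.filter⁺ (λ c → centreOf c ≟ c) (Unique.allFin⁺ n)

    m : ℕ
    m = length centres

    centre : Fin m → V G
    centre = lookup centres

    centreOf-centre : ∀ i → centreOf (centre i) ≡ centre i
    centreOf-centre i = proj₂ (∈-filter⁻ (λ c → centreOf c ≟ c) {xs = allFin n} (∈-lookup i))

    centreOf-nb-centre : ∀ i → centreOf (nb (centre i)) ≡ centre i
    centreOf-nb-centre i = trans (sym (∼⇒centreOf≡ (∼nb (centre i)))) (centreOf-centre i)

    centreOf∈centres : ∀ v → centreOf v ∈ centres
    centreOf∈centres v = ∈-filter⁺ (λ c → centreOf c ≟ c) (∈-allFin (centreOf v)) (centreOf-idem v)

    component : V G → Fin m
    component v = Any.index (centreOf∈centres v)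

    component-unique : ∀ {v i} → centreOf v ≡ centre i → component v ≡ i
    component-unique {v} = index-of-lookup unique-centres (centreOf∈centres v)

    centre-component : ∀ v → centre (component v) ≡ centreOf v
    centre-component v = sym (lookup-index (centreOf∈centres v))

    component≡⇒centreOf≡ : ∀ {u v} → component u ≡ component v → centreOf u ≡ centreOf v
    component≡⇒centreOf≡ {u} {v} eq =
      trans (sym (centre-component u)) (trans (cong centre eq) (centre-component v))

    ∼⇒component≡ : ∀ {u v} → u ∼ v → component u ≡ component v
    ∼⇒component≡ {v = v} u∼v = component-unique (trans (∼⇒centreOf≡ u∼v) (sym (centre-component v)))

    disjointUnionOfStars : DisjointUnionOfStars G m
    disjointUnionOfStars =
      component , centre , component-unique ∘ centreOf-centre ,
      (λ i → nb (centre i) , component-unique (centreOf-nb-centre i) ,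
             ≢-sym (∼⇒≢ (∼nb (centre i)))) ,
      (λ _ _ → ∼⇒component≡) ,
      λ u v same → Sum.map (at-centre u) (at-centre u) ∘ ∼⇒centreOf-endpoint ,
                   λ u≢v → Sum.[ (λ u≡c → ∼-sym (centreOf≡⇒∼ (centreOf-v≡ u v same u≡c) u≢v))
                           , (λ v≡c → centreOf≡⇒∼ (sym (at-centre⁻ u v≡c)) (≢-sym u≢v)) ]
      where
      at-centre : ∀ u {w} → w ≡ centreOf u → w ≡ centre (component u)
      at-centre u w≡c = trans w≡c (sym (centre-component u))
      at-centre⁻ : ∀ u {w} → w ≡ centre (component u) → w ≡ centreOf u
      at-centre⁻ u w≡c = trans w≡c (centre-component u)
      centreOf-v≡ : ∀ u v → component u ≡ component v → u ≡ centre (component u) → centreOf v ≡ u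
      centreOf-v≡ u v same u≡c = trans (sym (component≡⇒centreOf≡ same)) (sym (at-centre⁻ u u≡c))

    centresAndLeaves : List (V G)
    centresAndLeaves = map centre (allFin m) ++ map (nb ∘ centre) (allFin m)

    centre∈ : ∀ i → centre i ∈ centresAndLeaves
    centre∈ i = ∈-++⁺ˡ (∈-map⁺ centre (∈-allFin i))

    leaf∈ : ∀ i → nb (centre i) ∈ centresAndLeaves
    leaf∈ i = ∈-++⁺ʳ (map centre (allFin m)) (∈-map⁺ (nb ∘ centre) (∈-allFin i))

    ∈centresAndLeaves⁻ : ∀ {w} → w ∈ centresAndLeaves → w ≡ centreOf w ⊎ w ≡ nb (centreOf w)
    ∈centresAndLeaves⁻ w∈ with ∈-++⁻ (map centre (allFin m)) w∈
    ... | inj₁ w∈centres with ∈-map⁻ centre w∈centres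
    ...   | i , _ , refl = inj₁ (sym (centreOf-centre i))
    ∈centresAndLeaves⁻ w∈ | inj₂ w∈leaves with ∈-map⁻ (nb ∘ centre) w∈leaves
    ...   | i , _ , refl = inj₂ (cong nb (sym (centreOf-nb-centre i)))

    unique-centresAndLeaves : Unique centresAndLeaves
    unique-centresAndLeaves =
      Unique.++⁺ (Unique.map⁺ (injective centreOf-centre) (Unique.allFin⁺ m))
                 (Unique.map⁺ (injective centreOf-nb-centre) (Unique.allFin⁺ m))
                 disjoint
      where
      injective : ∀ {f : Fin m → V G} → (∀ i → centreOf (f i) ≡ centre i) →
                  ∀ {i j} → f i ≡ f j → i ≡ j
      injective {f} centreOf-f {i} {j} eq =
        trans (sym (component-unique (centreOf-f i)))
              (component-unique (trans (cong centreOf eq) (centreOf-f j)))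
      disjoint : ∀ {w} → ¬ (w ∈ map centre (allFin m) × w ∈ map (nb ∘ centre) (allFin m))
      disjoint (w∈centres , w∈leaves) with ∈-map⁻ centre w∈centres | ∈-map⁻ (nb ∘ centre) w∈leaves
      ... | i , _ , refl | j , _ , cᵢ≡nbcⱼ =
        let cᵢ≡cⱼ = trans (sym (centreOf-centre i))
                          (trans (cong centreOf cᵢ≡nbcⱼ) (centreOf-nb-centre j))
        in ∼⇒≢ (∼nb (centre j)) (trans (sym cᵢ≡cⱼ) cᵢ≡nbcⱼ)

    centresAndLeaves-privateNeighbour : ∀ {x} → x ∈ centresAndLeaves →
      ∃ (PrivateNeighbour [] centresAndLeaves x)
    centresAndLeaves-privateNeighbour {x} x∈ with ∈centresAndLeaves⁻ x∈
    ... | inj₁ x≡cx = nb x , ∼nb x , [] , only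
      where
      centreOf-w : ∀ {w} → w ∼ nb x → centreOf w ≡ x
      centreOf-w w∼nb = trans (∼⇒centreOf≡ w∼nb) (trans (sym (∼⇒centreOf≡ (∼nb x))) (sym x≡cx))
      only : ∀ {w} → w ∈ centresAndLeaves → w ∼ nb x → w ≡ x
      only w∈ w∼nb with ∈centresAndLeaves⁻ w∈
      ... | inj₁ w≡cw   = trans w≡cw (centreOf-w w∼nb)
      ... | inj₂ w≡nbcw = ⊥-elim (∼⇒≢ w∼nb (trans w≡nbcw (cong nb (centreOf-w w∼nb))))
    ... | inj₂ x≡nbcx = centreOf x , ∼centreOf x≢cx , [] , only
      where
      x≢cx : x ≢ centreOf x
      x≢cx x≡cx = ∼⇒≢ (∼nb x) (trans x≡nbcx (cong nb (sym x≡cx)))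
      centreOf-w : ∀ {w} → w ∼ centreOf x → centreOf w ≡ centreOf x
      centreOf-w w∼c = trans (∼⇒centreOf≡ w∼c) (centreOf-idem x)
      only : ∀ {w} → w ∈ centresAndLeaves → w ∼ centreOf x → w ≡ x
      only w∈ w∼c with ∈centresAndLeaves⁻ w∈
      ... | inj₁ w≡cw   = ⊥-elim (∼⇒≢ w∼c (trans w≡cw (centreOf-w w∼c)))
      ... | inj₂ w≡nbcw = trans w≡nbcw (trans (cong nb (centreOf-w w∼c)) (sym x≡nbcx))

    totalDominating-centresAndLeaves : TotalDominating G centresAndLeaves
    totalDominating-centresAndLeaves v with centreOf v ≟ v
    ... | yes cv≡v =
      nb v , subst (λ c → nb c ∈ centresAndLeaves) (trans (centre-component v) cv≡v) (leaf∈ (component v)) ,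
      ∼nb v
    ... | no cv≢v  =
      centreOf v , subst (_∈ centresAndLeaves) (centre-component v) (centre∈ (component v)) ,
      ∼centreOf (≢-sym cv≢v)

    length-centresAndLeaves : length centresAndLeaves ≡ 2 * m
    length-centresAndLeaves = begin
      length centresAndLeaves
        ≡⟨ length-++ (map centre (allFin m)) ⟩
      length (map centre (allFin m)) + length (map (nb ∘ centre) (allFin m))
        ≡⟨ cong₂ _+_ (length-map-allFin centre) (length-map-allFin (nb ∘ centre)) ⟩
      m + m
        ≡⟨ cong (m +_) (sym (+-identityʳ m)) ⟩
      2 * m ∎
      where
      open ≡-Reasoning
      length-map-allFin : (f : Fin m → V G) → length (map f (allFin m)) ≡ m
      length-map-allFin f = trans (length-map f (allFin m)) (length-tabulate id)

    uniform⇒starForest : ∀ {k} → TotalUniform G k → Σ ℕ λ m → 2 * m ≡ k × DisjointUnionOfStars G m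
    uniform⇒starForest (_ , (_ , γt-minimal) , (_ , γgr-maximal)) =
      m ,
      trans (sym length-centresAndLeaves)
            (≤-antisym (γgr-maximal centresAndLeaves tds) (γt-minimal centresAndLeaves uL td)) ,
      disjointUnionOfStars
      where
      uL = unique-centresAndLeaves
      td = totalDominating-centresAndLeaves
      tds : TotalDominatingSequence G centresAndLeaves
      tds = uL , legalFrom[]⇒legal (legalFrom-privateNeighbours [] centresAndLeaves uL
                                      centresAndLeaves-privateNeighbour) , td

theorem5p4 : (G : Graph) (k : ℕ) → TotalUniform G k →
    (Σ ℕ (λ m → 2 * m ≡ k × DisjointUnionOfStars G m)) ⊎ GirthAtMost6 G
theorem5p4 G k uniform@(noIsolated , _) with girth≤6⊎squareFree×hexagonFree G
... | inj₁ girth≤6                    = inj₂ girth≤6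
... | inj₂ (squareFree , hexagonFree) =
  inj₁ (StarForest.uniform⇒starForest G noIsolated walk₃-free uniform)
  where
  walk₃-free : ∀ {a b c d} → ¬ Walk₃ G a b c d
  walk₃-free = deadEnds⇒walk₃-free G λ v →
    ¬everyEdgeExtends⇒deadEnd G (uniform⇒¬everyEdgeExtends G squareFree hexagonFree v uniform)
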